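{- Let $m\ge 3$ and $n\ge 2$. For every positive integer $k$, $$\chi_{B_1(m,n)}(2k+1)=\Big[\sum_{i=0}^{m-2}(-1)^i(2k)^{(m-2)-i}\Big]\,\chi_{B_1(m,n-1)}(2k+1).$$
   Context: A signed graph $(G,\sigma)$ is a finite graph $G$ with a sign function $\sigma:E(G)\to\{+1,-1\}$; its signature is the set of negative edges. A signed coloring in $2k+1$ colors is a map $c:V(G)\to\{ -k,\dots,k\}$; it is proper if $c(y)\neq\sigma(e)c(x)$ for every edge $e=xy$. The signed chromatic polynomial $\chi_{(G,\sigma)}(2k+1)$ is the number of proper signed colorings in $2k+1$ colors. For integers $m\ge 3$, $n\ge 1$, the Book graph $B(m,n)$ has vertex set $\{u,v\}\cup\{u_j^l:1\le l\le n,\,1\le j\le m-2\}$ and consists of the $n$ cycles $u\,u_1^l\cdots u_{m-2}^l\,v\,u$ sharing the edge $uv$. For $1\le l\le n$, $B_l(m,n)$ denotes $B(m,n)$ with signature $\{uu_1^1,uu_1^2,\dots,uu_1^l\}$. -}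

module Defs where

open import Data.Bool using (Bool; true; false; if_then_else_; not; _∧_; T?)
open import Data.Nat as ℕ using (ℕ; zero; suc; _∸_; _<ᵇ_)
open import Data.Integer as ℤ using (ℤ; +_; -_; _-_; _*_; _^_)
open import Data.List using (List; []; _∷_; _++_; map; concatMap; upTo; filter; length; foldr)
open import Data.Vec using (Vec; []; _∷_)
open import Data.Product using (_×_; _,_)
open import Data.Maybe using (Maybe; just; nothing)
open import Relation.Nullary.Decidable using (does)
open import Relation.Unary using (Decidable)
open import Relation.Binary.PropositionalEquality using (_≡_)

data Sign : Set where
  pos neg : Sign

sgn : Sign → ℤ
sgn pos = + 1
sgn neg = - (+ 1)

-- A (finite) signed graph: vertices are 0,1,…,order-1; each edge is
-- (x , y , σ(e)) with endpoints x y (natural-number vertex indices).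
record SignedGraph : Set where
  constructor mkSG
  field
    order : ℕ
    edges : List (ℕ × ℕ × Sign)
open SignedGraph public

colours : ℕ → List ℤ
colours k = map (λ i → + i - + k) (upTo (suc (2 ℕ.* k)))

allMaps : List ℤ → (N : ℕ) → List (Vec ℤ N)
allMaps cs zero = [] ∷ []
allMaps cs (suc N) = concatMap (λ c → map (c ∷_) (allMaps cs N)) cs

at : {N : ℕ} → Vec ℤ N → ℕ → Maybe ℤ
at [] _ = nothing
at (a ∷ _) zero = just a
at (_ ∷ as) (suc i) = at as i

properEdge : {N : ℕ} → Vec ℤ N → ℕ × ℕ × Sign → Bool
properEdge c (x , y , s) with at c x | at c y
... | just a | just b = not (does (b ℤ.≟ sgn s * a))
... | _ | _ = false

proper : {N : ℕ} → Vec ℤ N → List (ℕ × ℕ × Sign) → Bool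
proper c es = foldr (λ e r → properEdge c e ∧ r) true es

-- signedChromatic G k  =  χ_G(2k+1): number of proper signed colourings in 2k+1 colours
signedChromatic : SignedGraph → ℕ → ℕ
signedChromatic G k =
  length (filter (λ c → T? (proper c (edges G))) (allMaps (colours k) (order G)))

-- Book graph B_s(m,n) with signature {u u_1^1, …, u u_1^s}.
-- Vertex indices: u = 0, v = 1, u_j^l = 2 + (l-1)(m-2) + (j-1)
-- (1 ≤ l ≤ n, 1 ≤ j ≤ m-2).  Below l and j are 0-based.
pageVertex : (L l j : ℕ) → ℕ
pageVertex L l j = 2 ℕ.+ (l ℕ.* L ℕ.+ j)

pageEdges : (s L l : ℕ) → List (ℕ × ℕ × Sign)
pageEdges s L l =
  (0 , pageVertex L l 0 , (if l <ᵇ s then neg else pos))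
  ∷ (map (λ j → (pageVertex L l j , pageVertex L l (suc j) , pos)) (upTo (L ∸ 1))
     ++ ((pageVertex L l (L ∸ 1) , 1 , pos) ∷ []))

Book : (s m n : ℕ) → SignedGraph
Book s m n = mkSG (2 ℕ.+ n ℕ.* (m ∸ 2))
                  ((0 , 1 , pos) ∷ concatMap (pageEdges s (m ∸ 2)) (upTo n))

factor : (m k : ℕ) → ℤ
factor m k = foldr ℤ._+_ (+ 0)
  (map (λ i → ((- (+ 1)) ^ i) * ((+ (2 ℕ.* k)) ^ ((m ∸ 2) ∸ i))) (upTo (suc (m ∸ 2))))

module Submission where

-- Fix 2k+1 = p+2 colours.  A colouring of B_1(m,n) splits into a colouring x
-- of B_1(m,n-1) (the first 2 + (n-1)(m-2) vertices) and a colouring y of the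
-- m-2 interior vertices of the last page.  Since n ≥ 2 the last page carries
-- no negative edge, so it is properly coloured iff  x(u), y, x(v)  is a walk
-- with distinct neighbouring colours.  The number of such walks through L
-- interior vertices depends only on whether x(u) ≠ x(v); it is  apart p L
-- resp.  same p L  (mutually recursive counts, obtained by splitting off
-- the first interior colour).  Properness of x forces x(u) ≠ x(v) because uv
-- is a positive edge, hence  χ_{B_1(m,n)} = apart p (m-2) · χ_{B_1(m,n-1)}.
-- Finally  apart p L + apart p (L-1) = (p+1)^L , which identifies
-- apart p L with the alternating sum  Σ_{i ≤ L} (-1)^i (2k)^{L-i}.

open import Defs
open import Data.Bool using (Bool; true; false; if_then_else_; not; _∧_; T?)
open import Data.Bool.Properties using (∧-assoc; ∧-identityʳ; ∧-conicalˡ)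
open import Data.Nat as ℕ using (ℕ; zero; suc; _≤_; _<_; _∸_; s≤s; z≤n)
import Data.Nat.Properties as ℕP
open import Data.Nat.Tactic.RingSolver using (solve-∀)
open import Data.Integer as ℤ using (ℤ; +_; -_; _-_; _*_; _^_)
import Data.Integer.Properties as ℤP
import Data.Integer.Tactic.RingSolver as ℤSolver
open import Data.List using (List; []; _∷_; _++_; map; concatMap; upTo; applyUpTo; filter; length; foldr; [_])
import Data.List.Properties as LP
open import Data.List.Relation.Unary.All as All using (All; []; _∷_)
import Data.List.Relation.Unary.All.Properties as AllP
open import Data.List.Membership.Propositional using (_∈_)
open import Data.List.Relation.Unary.Any using (here; there)
open import Data.List.Relation.Unary.AllPairs using (_∷_)
open import Data.List.Relation.Unary.Unique.Propositional using (Unique)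
import Data.List.Relation.Unary.Unique.Propositional.Properties as UniqueP
open import Data.Vec using (Vec; []; _∷_) renaming (_++_ to _++ᵛ_)
import Data.Vec.Relation.Unary.All as VAll
open import Data.Product using (_×_; _,_)
open import Data.Maybe using (Maybe; just; nothing)
open import Relation.Nullary.Decidable using (does; yes; no; dec-true; dec-false)
open import Relation.Binary.PropositionalEquality hiding ([_])

Edge : Set
Edge = ℕ × ℕ × Sign

𝟙 : Bool → ℕ
𝟙 b = if b then 1 else 0

𝟙-∧ : (a b : Bool) → 𝟙 (a ∧ b) ≡ 𝟙 a ℕ.* 𝟙 b
𝟙-∧ true b = sym (ℕP.*-identityˡ (𝟙 b))
𝟙-∧ false b = refl

sumOver : {A : Set} → (A → ℕ) → List A → ℕ
sumOver h [] = 0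
sumOver h (x ∷ xs) = h x ℕ.+ sumOver h xs

length-filter : {A : Set} (p : A → Bool) (xs : List A) →
  length (filter (λ x → T? (p x)) xs) ≡ sumOver (λ x → 𝟙 (p x)) xs
length-filter p [] = refl
length-filter p (x ∷ xs) with p x
... | true = cong suc (length-filter p xs)
... | false = length-filter p xs

sumOver-++ : {A : Set} (h : A → ℕ) (xs ys : List A) →
  sumOver h (xs ++ ys) ≡ sumOver h xs ℕ.+ sumOver h ys
sumOver-++ h [] ys = refl
sumOver-++ h (x ∷ xs) ys =
  trans (cong (h x ℕ.+_) (sumOver-++ h xs ys)) (sym (ℕP.+-assoc (h x) _ _))

sumOver-map : {A B : Set} (h : B → ℕ) (g : A → B) (xs : List A) →
  sumOver h (map g xs) ≡ sumOver (λ x → h (g x)) xs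
sumOver-map h g [] = refl
sumOver-map h g (x ∷ xs) = cong (h (g x) ℕ.+_) (sumOver-map h g xs)

sumOver-concatMap : {A B : Set} (h : B → ℕ) (f : A → List B) (xs : List A) →
  sumOver h (concatMap f xs) ≡ sumOver (λ x → sumOver h (f x)) xs
sumOver-concatMap h f [] = refl
sumOver-concatMap h f (x ∷ xs) =
  trans (sumOver-++ h (f x) (concatMap f xs)) (cong (sumOver h (f x) ℕ.+_) (sumOver-concatMap h f xs))

sumOver-cong : {A : Set} {h h′ : A → ℕ} (xs : List A) →
  All (λ x → h x ≡ h′ x) xs → sumOver h xs ≡ sumOver h′ xs
sumOver-cong [] [] = refl
sumOver-cong (x ∷ xs) (e ∷ es) = cong₂ ℕ._+_ e (sumOver-cong xs es)

sumOver-ext : {A : Set} {h h′ : A → ℕ} (xs : List A) →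
  (∀ x → h x ≡ h′ x) → sumOver h xs ≡ sumOver h′ xs
sumOver-ext xs e = sumOver-cong xs (All.tabulate (λ {x} _ → e x))

sumOver-scale : {A : Set} (c : ℕ) (h : A → ℕ) (xs : List A) →
  sumOver (λ x → c ℕ.* h x) xs ≡ c ℕ.* sumOver h xs
sumOver-scale c h [] = sym (ℕP.*-zeroʳ c)
sumOver-scale c h (x ∷ xs) =
  trans (cong (c ℕ.* h x ℕ.+_) (sumOver-scale c h xs)) (sym (ℕP.*-distribˡ-+ c (h x) _))

sumOver-one : {A : Set} (xs : List A) → sumOver (λ _ → 1) xs ≡ length xs
sumOver-one [] = refl
sumOver-one (x ∷ xs) = cong suc (sumOver-one xs)

sumOver-allMaps-++ : (cs : List ℤ) (a b : ℕ) (h : Vec ℤ (a ℕ.+ b) → ℕ) →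
  sumOver h (allMaps cs (a ℕ.+ b))
    ≡ sumOver (λ x → sumOver (λ y → h (x ++ᵛ y)) (allMaps cs b)) (allMaps cs a)
sumOver-allMaps-++ cs zero b h = sym (ℕP.+-identityʳ _)
sumOver-allMaps-++ cs (suc a) b h = begin
    sumOver h (concatMap (λ c → map (c ∷_) (allMaps cs (a ℕ.+ b))) cs)
  ≡⟨ sumOver-concatMap h _ cs ⟩
    sumOver (λ c → sumOver h (map (c ∷_) (allMaps cs (a ℕ.+ b)))) cs
  ≡⟨ sumOver-ext cs (λ c → trans (sumOver-map h (c ∷_) (allMaps cs (a ℕ.+ b))) (sumOver-allMaps-++ cs a b (λ z → h (c ∷ z)))) ⟩
    sumOver (λ c → sumOver (λ x → inner (c ∷ x)) (allMaps cs a)) cs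
  ≡⟨ sumOver-ext cs (λ c → sym (sumOver-map inner (c ∷_) (allMaps cs a))) ⟩
    sumOver (λ c → sumOver inner (map (c ∷_) (allMaps cs a))) cs
  ≡⟨ sym (sumOver-concatMap inner _ cs) ⟩
    sumOver inner (allMaps cs (suc a))
  ∎
  where
  open ≡-Reasoning
  inner : Vec ℤ (suc a) → ℕ
  inner x = sumOver (λ y → h (x ++ᵛ y)) (allMaps cs b)

allMaps-∈ : (cs : List ℤ) (N : ℕ) → All (VAll.All (_∈ cs)) (allMaps cs N)
allMaps-∈ cs zero = VAll.[] ∷ []
allMaps-∈ cs (suc N) =
  AllP.concat⁺ (AllP.map⁺ (All.tabulate (λ c∈cs → AllP.map⁺ (All.map (c∈cs VAll.∷_) (allMaps-∈ cs N)))))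

colours-unique : (k : ℕ) → Unique (colours k)
colours-unique k = UniqueP.map⁺ shift-injective (UniqueP.upTo⁺ _)
  where
  shift-injective : {i j : ℕ} → + i - + k ≡ + j - + k → i ≡ j
  shift-injective {i} {j} e = ℤP.+-injective (begin
      + i                  ≡⟨ back (+ i) (+ k) ⟩
      (+ i - + k) ℤ.+ + k  ≡⟨ cong (ℤ._+ + k) e ⟩
      (+ j - + k) ℤ.+ + k  ≡⟨ sym (back (+ j) (+ k)) ⟩
      + j                  ∎)
    where
    open ≡-Reasoning
    back : ∀ x y → x ≡ (x - y) ℤ.+ y
    back = ℤSolver.solve-∀

colours-length : (k : ℕ) → length (colours k) ≡ suc (2 ℕ.* k)
colours-length k = trans (LP.length-map _ (upTo (suc (2 ℕ.* k)))) (LP.length-upTo _)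

differ : ℤ → ℤ → Bool
differ a b = not (does (a ℤ.≟ b))

differ-self : (a : ℤ) → differ a a ≡ false
differ-self a = cong not (dec-true (a ℤ.≟ a) refl)

differ-≢ : {a c : ℤ} → a ≢ c → differ a c ≡ true
differ-≢ {a} {c} a≢c = cong not (dec-false (a ℤ.≟ c) a≢c)

differ-sym : (a b : ℤ) → differ a b ≡ differ b a
differ-sym a b with a ℤ.≟ b
... | yes a≡b = sym (cong not (dec-true (b ℤ.≟ a) (sym a≡b)))
... | no a≢b = sym (cong not (dec-false (b ℤ.≟ a) (λ b≡a → a≢b (sym b≡a))))

edgeOK : Sign → Maybe ℤ → Maybe ℤ → Bool
edgeOK s (just a) (just b) = not (does (b ℤ.≟ sgn s * a))
edgeOK s _ _ = false

properEdge≡edgeOK : {N : ℕ} (c : Vec ℤ N) (i j : ℕ) (s : Sign) →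
  properEdge c (i , j , s) ≡ edgeOK s (at c i) (at c j)
properEdge≡edgeOK c i j s with at c i | at c j
... | just a | just b = refl
... | just a | nothing = refl
... | nothing | just b = refl
... | nothing | nothing = refl

edgeOK-pos : (a b : ℤ) → edgeOK pos (just a) (just b) ≡ differ a b
edgeOK-pos a b = trans (cong (λ z → not (does (b ℤ.≟ z))) (ℤP.*-identityˡ a)) (differ-sym b a)

proper-++ : {N : ℕ} (c : Vec ℤ N) (es fs : List Edge) →
  proper c (es ++ fs) ≡ proper c es ∧ proper c fs
proper-++ c [] fs = refl
proper-++ c (e ∷ es) fs =
  trans (cong (properEdge c e ∧_) (proper-++ c es fs)) (sym (∧-assoc (properEdge c e) _ _))

at-++ˡ : {N M : ℕ} (x : Vec ℤ N) (y : Vec ℤ M) (i : ℕ) → i < N → at (x ++ᵛ y) i ≡ at x i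
at-++ˡ (a ∷ x) y zero _ = refl
at-++ˡ (a ∷ x) y (suc i) (s≤s i<N) = at-++ˡ x y i i<N

at-++ʳ : {N M : ℕ} (x : Vec ℤ N) (y : Vec ℤ M) (j : ℕ) → at (x ++ᵛ y) (N ℕ.+ j) ≡ at y j
at-++ʳ [] y j = refl
at-++ʳ (a ∷ x) y j = at-++ʳ x y j

Within : ℕ → Edge → Set
Within N (i , j , s) = i < N × j < N

proper-prefix : {N M : ℕ} (x : Vec ℤ N) (y : Vec ℤ M) (es : List Edge) →
  All (Within N) es → proper (x ++ᵛ y) es ≡ proper x es
proper-prefix x y [] [] = refl
proper-prefix x y ((i , j , s) ∷ es) ((i<N , j<N) ∷ within) = cong₂ _∧_
  (begin
    properEdge (x ++ᵛ y) (i , j , s)              ≡⟨ properEdge≡edgeOK (x ++ᵛ y) i j s ⟩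
    edgeOK s (at (x ++ᵛ y) i) (at (x ++ᵛ y) j)   ≡⟨ cong₂ (edgeOK s) (at-++ˡ x y i i<N) (at-++ˡ x y j j<N) ⟩
    edgeOK s (at x i) (at x j)                   ≡⟨ sym (properEdge≡edgeOK x i j s) ⟩
    properEdge x (i , j , s)                     ∎)
  (proper-prefix x y es within)
  where open ≡-Reasoning

chainOK : (ℕ → Maybe ℤ) → ℕ → Bool
chainOK f zero = true
chainOK f (suc l) = edgeOK pos (f 0) (f 1) ∧ chainOK (λ j → f (suc j)) l

chainOK-cong : {f g : ℕ → Maybe ℤ} (l : ℕ) → (∀ j → f j ≡ g j) → chainOK f l ≡ chainOK g l
chainOK-cong zero e = refl
chainOK-cong (suc l) e = cong₂ _∧_ (cong₂ (edgeOK pos) (e 0) (e 1)) (chainOK-cong l (λ j → e (suc j)))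

proper-chain : {N : ℕ} (c : Vec ℤ N) (v : ℕ → ℕ) (l : ℕ) →
  proper c (applyUpTo (λ j → (v j , v (suc j) , pos)) l) ≡ chainOK (λ j → at c (v j)) l
proper-chain c v zero = refl
proper-chain c v (suc l) =
  cong₂ _∧_ (properEdge≡edgeOK c (v 0) (v 1) pos) (proper-chain c (λ j → v (suc j)) l)

walkOK : ℤ → {n : ℕ} → Vec ℤ n → ℤ → Bool
walkOK a [] b = differ a b
walkOK a (c ∷ y) b = differ a c ∧ walkOK c y b

walkOK-chain : (l : ℕ) (c : ℤ) (y : Vec ℤ l) (b : ℤ) →
  walkOK c y b ≡ chainOK (at (c ∷ y)) l ∧ edgeOK pos (at (c ∷ y) l) (just b)
walkOK-chain zero c [] b = sym (edgeOK-pos c b)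
walkOK-chain (suc l) c (d ∷ y) b =
  trans (cong₂ _∧_ (sym (edgeOK-pos c d)) (walkOK-chain l d y b))
        (sym (∧-assoc (edgeOK pos (just c) (just d)) (chainOK (at (d ∷ y)) l) (edgeOK pos (at (d ∷ y) l) (just b))))

Book-edges-suc : (s m n : ℕ) →
  edges (Book s m (suc n)) ≡ edges (Book s m n) ++ pageEdges s (m ∸ 2) n
Book-edges-suc s m n = cong ((0 , 1 , pos) ∷_) (begin
    concatMap page (upTo (suc n))           ≡⟨ cong (concatMap page) (sym (LP.upTo-∷ʳ n)) ⟩
    concatMap page (upTo n ++ [ n ])        ≡⟨ LP.concatMap-++ page (upTo n) [ n ] ⟩
    concatMap page (upTo n) ++ page n ++ [] ≡⟨ cong (concatMap page (upTo n) ++_) (LP.++-identityʳ (page n)) ⟩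
    concatMap page (upTo n) ++ page n       ∎)
  where
  open ≡-Reasoning
  page : ℕ → List Edge
  page = pageEdges s (m ∸ 2)

pageVertex-< : (l n i j : ℕ) → i < n → j ≤ l → pageVertex (suc l) i j < 2 ℕ.+ n ℕ.* suc l
pageVertex-< l n i j i<n j≤l = s≤s (s≤s (begin-strict
    i ℕ.* suc l ℕ.+ j      <⟨ ℕP.+-monoʳ-< (i ℕ.* suc l) (s≤s j≤l) ⟩
    i ℕ.* suc l ℕ.+ suc l  ≡⟨ ℕP.+-comm (i ℕ.* suc l) (suc l) ⟩
    suc i ℕ.* suc l        ≤⟨ ℕP.*-monoˡ-≤ (suc l) i<n ⟩
    n ℕ.* suc l            ∎))
  where open ℕP.≤-Reasoning

Book-wellFormed : (s l n : ℕ) →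
  All (Within (order (Book s (3 ℕ.+ l) n))) (edges (Book s (3 ℕ.+ l) n))
Book-wellFormed s l n = (s≤s z≤n , s≤s (s≤s z≤n))
  ∷ AllP.concat⁺ (AllP.map⁺ (AllP.applyUpTo⁺₁ _ n page-within))
  where
  vertex : ∀ {i} j → i < n → j ≤ l → pageVertex (suc l) i j < 2 ℕ.+ n ℕ.* suc l
  vertex {i} j = pageVertex-< l n i j
  page-within : ∀ {i} → i < n → All (Within (2 ℕ.+ n ℕ.* suc l)) (pageEdges s (suc l) i)
  page-within i<n = (s≤s z≤n , vertex 0 i<n z≤n)
    ∷ AllP.++⁺ (AllP.map⁺ (AllP.applyUpTo⁺₁ _ l (λ {j} j<l → vertex j i<n (ℕP.<⇒≤ j<l) , vertex (suc j) i<n j<l)))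
               ((vertex l i<n ℕP.≤-refl , s≤s (s≤s z≤n)) ∷ [])

-- A page of B_1 other than the first is positive: colouring B_1(l+3, n+1)
-- by x = (a, b, …) and its new page by y, the page is proper iff a, y, b is
-- a proper walk.
lastPage-proper : (l n : ℕ) (a b : ℤ) (r : Vec ℤ (suc n ℕ.* suc l)) (y : Vec ℤ (suc l)) →
  proper ((a ∷ b ∷ r) ++ᵛ y) (pageEdges 1 (suc l) (suc n)) ≡ walkOK a y b
lastPage-proper l n a b r (c ∷ y′) = begin
    properEdge z first ∧ proper z (middle ++ [ last ])
  ≡⟨ cong (properEdge z first ∧_) (proper-++ z middle [ last ]) ⟩
    properEdge z first ∧ (proper z middle ∧ (properEdge z last ∧ true))
  ≡⟨ cong₂ _∧_ first-ok (cong₂ _∧_ middle-ok (trans (∧-identityʳ _) last-ok)) ⟩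
    differ a c ∧ (chainOK (at y) l ∧ edgeOK pos (at y l) (just b))
  ≡⟨ cong (differ a c ∧_) (sym (walkOK-chain l c y′ b)) ⟩
    differ a c ∧ walkOK c y′ b
  ∎
  where
  open ≡-Reasoning
  x : Vec ℤ (2 ℕ.+ suc n ℕ.* suc l)
  x = a ∷ b ∷ r
  y : Vec ℤ (suc l)
  y = c ∷ y′
  z : Vec ℤ (2 ℕ.+ suc n ℕ.* suc l ℕ.+ suc l)
  z = x ++ᵛ y
  vertex : ℕ → ℕ
  vertex = pageVertex (suc l) (suc n)
  first last : Edge
  first = (0 , vertex 0 , pos)
  last = (vertex l , 1 , pos)
  middle : List Edge
  middle = map (λ j → (vertex j , vertex (suc j) , pos)) (upTo l)
  first-ok : properEdge z first ≡ differ a c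
  first-ok = trans (properEdge≡edgeOK z 0 (vertex 0) pos)
                   (trans (cong (edgeOK pos (just a)) (at-++ʳ x y 0)) (edgeOK-pos a c))
  last-ok : properEdge z last ≡ edgeOK pos (at y l) (just b)
  last-ok = trans (properEdge≡edgeOK z (vertex l) 1 pos)
                  (cong (λ w → edgeOK pos w (just b)) (at-++ʳ x y l))
  middle-ok : proper z middle ≡ chainOK (at y) l
  middle-ok = trans (cong (proper z) (LP.map-upTo _ l))
                    (trans (proper-chain z vertex l) (chainOK-cong l (at-++ʳ x y)))

Book-extend-proper : (l n : ℕ) (a b : ℤ) (r : Vec ℤ (suc n ℕ.* suc l)) (y : Vec ℤ (suc l)) →
  proper ((a ∷ b ∷ r) ++ᵛ y) (edges (Book 1 (3 ℕ.+ l) (2 ℕ.+ n)))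
    ≡ proper (a ∷ b ∷ r) (edges (Book 1 (3 ℕ.+ l) (suc n))) ∧ walkOK a y b
Book-extend-proper l n a b r y = begin
    proper (x ++ᵛ y) (edges (Book 1 (3 ℕ.+ l) (2 ℕ.+ n)))
  ≡⟨ cong (proper (x ++ᵛ y)) (Book-edges-suc 1 (3 ℕ.+ l) (suc n)) ⟩
    proper (x ++ᵛ y) (old ++ pageEdges 1 (suc l) (suc n))
  ≡⟨ proper-++ (x ++ᵛ y) old _ ⟩
    proper (x ++ᵛ y) old ∧ proper (x ++ᵛ y) (pageEdges 1 (suc l) (suc n))
  ≡⟨ cong₂ _∧_ (proper-prefix x y old (Book-wellFormed 1 l (suc n))) (lastPage-proper l n a b r y) ⟩
    proper x old ∧ walkOK a y b
  ∎
  where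
  open ≡-Reasoning
  x : Vec ℤ (2 ℕ.+ suc n ℕ.* suc l)
  x = a ∷ b ∷ r
  old : List Edge
  old = edges (Book 1 (3 ℕ.+ l) (suc n))

-- uv is a positive edge of every Book graph, so a proper colouring gives u
-- and v different colours
proper-ends-differ : (s m n : ℕ) {N : ℕ} (a b : ℤ) (r : Vec ℤ N) →
  proper (a ∷ b ∷ r) (edges (Book s m n)) ≡ true → differ a b ≡ true
proper-ends-differ s m n a b r x-proper = trans (sym (edgeOK-pos a b)) (∧-conicalˡ _ _ x-proper)

-- Counting proper walks

walks : List ℤ → (n : ℕ) → ℤ → ℤ → ℕ
walks cs n a b = sumOver (λ y → 𝟙 (walkOK a y b)) (allMaps cs n)

walks-suc : (cs : List ℤ) (n : ℕ) (a b : ℤ) →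
  walks cs (suc n) a b ≡ sumOver (λ c → 𝟙 (differ a c) ℕ.* walks cs n c b) cs
walks-suc cs n a b = trans (sumOver-concatMap _ _ cs) (sumOver-ext cs (λ c → begin
    sumOver (λ y → 𝟙 (walkOK a y b)) (map (c ∷_) (allMaps cs n))
  ≡⟨ sumOver-map _ (c ∷_) (allMaps cs n) ⟩
    sumOver (λ y → 𝟙 (differ a c ∧ walkOK c y b)) (allMaps cs n)
  ≡⟨ sumOver-ext (allMaps cs n) (λ y → 𝟙-∧ (differ a c) (walkOK c y b)) ⟩
    sumOver (λ y → 𝟙 (differ a c) ℕ.* 𝟙 (walkOK c y b)) (allMaps cs n)
  ≡⟨ sumOver-scale (𝟙 (differ a c)) _ (allMaps cs n) ⟩
    𝟙 (differ a c) ℕ.* walks cs n c b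
  ∎))
  where open ≡-Reasoning

sumOver-split : (cs : List ℤ) → Unique cs → {a : ℤ} → a ∈ cs → (h : ℤ → ℕ) →
  sumOver h cs ≡ h a ℕ.+ sumOver (λ c → 𝟙 (differ a c) ℕ.* h c) cs
sumOver-split (a ∷ cs) (a∉cs ∷ _) (here refl) h = cong (h a ℕ.+_) (begin
    sumOver h cs
  ≡⟨ sumOver-cong cs (All.map (λ {c} a≢c → sym (trans (cong (λ β → 𝟙 β ℕ.* h c) (differ-≢ a≢c))
                                                        (ℕP.*-identityˡ (h c)))) a∉cs) ⟩
    sumOver (λ c → 𝟙 (differ a c) ℕ.* h c) cs
  ≡⟨ cong (λ β → 𝟙 β ℕ.* h a ℕ.+ sumOver (λ c → 𝟙 (differ a c) ℕ.* h c) cs) (sym (differ-self a)) ⟩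
    𝟙 (differ a a) ℕ.* h a ℕ.+ sumOver (λ c → 𝟙 (differ a c) ℕ.* h c) cs
  ∎)
  where open ≡-Reasoning
sumOver-split (d ∷ cs) (d∉cs ∷ unique) {a} (there a∈cs) h = begin
    h d ℕ.+ sumOver h cs
  ≡⟨ cong (h d ℕ.+_) (sumOver-split cs unique a∈cs h) ⟩
    h d ℕ.+ (h a ℕ.+ rest)
  ≡⟨ swap (h d) (h a) rest ⟩
    h a ℕ.+ (h d ℕ.+ rest)
  ≡⟨ cong (λ w → h a ℕ.+ (w ℕ.+ rest)) (sym (ℕP.*-identityˡ (h d))) ⟩
    h a ℕ.+ (1 ℕ.* h d ℕ.+ rest)
  ≡⟨ cong (λ β → h a ℕ.+ (𝟙 β ℕ.* h d ℕ.+ rest)) (sym (differ-≢ a≢d)) ⟩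
    h a ℕ.+ (𝟙 (differ a d) ℕ.* h d ℕ.+ rest)
  ∎
  where
  open ≡-Reasoning
  rest : ℕ
  rest = sumOver (λ c → 𝟙 (differ a c) ℕ.* h c) cs
  a≢d : a ≢ d
  a≢d a≡d = All.lookup d∉cs (subst (_∈ cs) a≡d a∈cs) refl
  swap : ∀ u v w → u ℕ.+ (v ℕ.+ w) ≡ v ℕ.+ (u ℕ.+ w)
  swap = solve-∀

count-others : (cs : List ℤ) (p : ℕ) → Unique cs → length cs ≡ 2 ℕ.+ p →
  {b : ℤ} → b ∈ cs → sumOver (λ c → 𝟙 (differ b c)) cs ≡ suc p
count-others cs p unique len {b} b∈cs = ℕP.suc-injective (begin
    suc (sumOver (λ c → 𝟙 (differ b c)) cs)
  ≡⟨ cong suc (sumOver-ext cs (λ c → sym (ℕP.*-identityʳ (𝟙 (differ b c))))) ⟩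
    1 ℕ.+ sumOver (λ c → 𝟙 (differ b c) ℕ.* 1) cs
  ≡⟨ sym (sumOver-split cs unique b∈cs (λ _ → 1)) ⟩
    sumOver (λ _ → 1) cs
  ≡⟨ trans (sumOver-one cs) len ⟩
    suc (suc p)
  ∎)
  where open ≡-Reasoning

mutual
  -- proper walks through n interior vertices in p+2 colours between two
  -- different (apart) resp. equal (same) end colours
  apart : ℕ → ℕ → ℕ
  apart p zero = 1
  apart p (suc n) = same p n ℕ.+ p ℕ.* apart p n

  same : ℕ → ℕ → ℕ
  same p zero = 0
  same p (suc n) = suc p ℕ.* apart p n

walkCount : ℕ → ℕ → Bool → ℕ
walkCount p n endsDiffer = if endsDiffer then apart p n else same p n

walkCount-step : (p n : ℕ) (β : Bool) (X : ℕ) →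
  walkCount p n β ℕ.+ X ≡ same p n ℕ.+ suc p ℕ.* apart p n → X ≡ walkCount p (suc n) β
walkCount-step p n true X e =
  ℕP.+-cancelˡ-≡ (apart p n) X _ (trans e (regroup p (apart p n) (same p n)))
  where
  regroup : ∀ p f g → g ℕ.+ suc p ℕ.* f ≡ f ℕ.+ (g ℕ.+ p ℕ.* f)
  regroup = solve-∀
walkCount-step p n false X e = ℕP.+-cancelˡ-≡ (same p n) X _ e

walks≡walkCount : (cs : List ℤ) (p : ℕ) → Unique cs → length cs ≡ 2 ℕ.+ p →
  (n : ℕ) {a b : ℤ} → a ∈ cs → b ∈ cs → walks cs n a b ≡ walkCount p n (differ a b)
walks≡walkCount cs p unique len zero {a} {b} _ _ with differ a b
... | true = refl
... | false = refl
walks≡walkCount cs p unique len (suc n) {a} {b} a∈cs b∈cs =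
  trans (walks-suc cs n a b)
    (trans (sumOver-cong cs (All.tabulate (λ c∈cs → cong (𝟙 (differ a _) ℕ.*_)
              (walks≡walkCount cs p unique len n c∈cs b∈cs))))
           (walkCount-step p n (differ a b) _ (trans (sym (sumOver-split cs unique a∈cs H)) total)))
  where
  -- With H c the count of walks from c (known by induction), Σ_c H c splits
  -- at a into H a + walks (n+1) a b, and at b into same + (p+1)·apart.
  H : ℤ → ℕ
  H c = walkCount p n (differ c b)
  apart-term : ∀ c → 𝟙 (differ b c) ℕ.* H c ≡ apart p n ℕ.* 𝟙 (differ b c)
  apart-term c rewrite differ-sym b c with differ c b
  ... | true = ℕP.*-comm 1 (apart p n)
  ... | false = sym (ℕP.*-zeroʳ (apart p n))
  total : sumOver H cs ≡ same p n ℕ.+ suc p ℕ.* apart p n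
  total = begin
      sumOver H cs
    ≡⟨ sumOver-split cs unique b∈cs H ⟩
      H b ℕ.+ sumOver (λ c → 𝟙 (differ b c) ℕ.* H c) cs
    ≡⟨ cong₂ ℕ._+_ (cong (walkCount p n) (differ-self b)) (sumOver-ext cs apart-term) ⟩
      same p n ℕ.+ sumOver (λ c → apart p n ℕ.* 𝟙 (differ b c)) cs
    ≡⟨ cong (same p n ℕ.+_) (trans (sumOver-scale (apart p n) _ cs) (cong (apart p n ℕ.*_) (count-others cs p unique len b∈cs))) ⟩
      same p n ℕ.+ apart p n ℕ.* suc p
    ≡⟨ cong (same p n ℕ.+_) (ℕP.*-comm (apart p n) (suc p)) ⟩
      same p n ℕ.+ suc p ℕ.* apart p n
    ∎
    where open ≡-Reasoning

-- all walks from a fixed colour: (p+1)^(n+1)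
apart-same-total : (p n : ℕ) → suc p ℕ.* apart p n ℕ.+ same p n ≡ suc p ℕ.^ suc n
apart-same-total p zero = ℕP.+-identityʳ _
apart-same-total p (suc n) =
  trans (regroup p (apart p n) (same p n)) (cong (suc p ℕ.*_) (apart-same-total p n))
  where
  regroup : ∀ p f g → suc p ℕ.* (g ℕ.+ p ℕ.* f) ℕ.+ suc p ℕ.* f ≡ suc p ℕ.* (suc p ℕ.* f ℕ.+ g)
  regroup = solve-∀

apart-recurrence : (p n : ℕ) → apart p (suc n) ℕ.+ apart p n ≡ suc p ℕ.^ suc n
apart-recurrence p n = trans (regroup p (apart p n) (same p n)) (apart-same-total p n)
  where
  regroup : ∀ p f g → g ℕ.+ p ℕ.* f ℕ.+ f ≡ suc p ℕ.* f ℕ.+ g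
  regroup = solve-∀

-- Deleting the last page

extensions-count : (cs : List ℤ) (p : ℕ) → Unique cs → length cs ≡ 2 ℕ.+ p →
  (l n : ℕ) {a b : ℤ} (r : Vec ℤ (suc n ℕ.* suc l)) → a ∈ cs → b ∈ cs →
  sumOver (λ y → 𝟙 (proper ((a ∷ b ∷ r) ++ᵛ y) (edges (Book 1 (3 ℕ.+ l) (2 ℕ.+ n))))) (allMaps cs (suc l))
    ≡ apart p (suc l) ℕ.* 𝟙 (proper (a ∷ b ∷ r) (edges (Book 1 (3 ℕ.+ l) (suc n))))
extensions-count cs p unique len l n {a} {b} r a∈cs b∈cs = begin
    sumOver (λ y → 𝟙 (proper (x ++ᵛ y) (edges (Book 1 (3 ℕ.+ l) (2 ℕ.+ n))))) (allMaps cs L)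
  ≡⟨ sumOver-ext (allMaps cs L) (λ y → cong 𝟙 (Book-extend-proper l n a b r y)) ⟩
    sumOver (λ y → 𝟙 (x-proper ∧ walkOK a y b)) (allMaps cs L)
  ≡⟨ sumOver-ext (allMaps cs L) (λ y → 𝟙-∧ x-proper (walkOK a y b)) ⟩
    sumOver (λ y → 𝟙 x-proper ℕ.* 𝟙 (walkOK a y b)) (allMaps cs L)
  ≡⟨ sumOver-scale (𝟙 x-proper) _ (allMaps cs L) ⟩
    𝟙 x-proper ℕ.* walks cs L a b
  ≡⟨ ends-differ x-proper refl ⟩
    apart p L ℕ.* 𝟙 x-proper
  ∎
  where
  open ≡-Reasoning
  L : ℕ
  L = suc l
  x : Vec ℤ (2 ℕ.+ suc n ℕ.* suc l)
  x = a ∷ b ∷ r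
  x-proper : Bool
  x-proper = proper x (edges (Book 1 (3 ℕ.+ l) (suc n)))
  -- only colourings x with x(u) ≠ x(v) contribute
  ends-differ : (β : Bool) → x-proper ≡ β → 𝟙 β ℕ.* walks cs L a b ≡ apart p L ℕ.* 𝟙 β
  ends-differ false _ = sym (ℕP.*-zeroʳ (apart p L))
  ends-differ true proper-x = begin
      1 ℕ.* walks cs L a b        ≡⟨ ℕP.*-identityˡ _ ⟩
      walks cs L a b              ≡⟨ walks≡walkCount cs p unique len L a∈cs b∈cs ⟩
      walkCount p L (differ a b)  ≡⟨ cong (walkCount p L) (proper-ends-differ 1 (3 ℕ.+ l) (suc n) a b r proper-x) ⟩
      apart p L                   ≡⟨ sym (ℕP.*-identityʳ (apart p L)) ⟩
      apart p L ℕ.* 1             ∎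

deletePage : (l n k : ℕ) →
  signedChromatic (Book 1 (3 ℕ.+ l) (2 ℕ.+ n)) (suc k)
    ≡ apart (ℕ.pred (2 ℕ.* suc k)) (suc l) ℕ.* signedChromatic (Book 1 (3 ℕ.+ l) (suc n)) (suc k)
deletePage l n k = begin
    signedChromatic (Book 1 m (2 ℕ.+ n)) (suc k)
  ≡⟨ length-filter _ (allMaps cs (2 ℕ.+ (L ℕ.+ suc n ℕ.* L))) ⟩
    countNew (2 ℕ.+ (L ℕ.+ suc n ℕ.* L))
  ≡⟨ cong (λ w → countNew (2 ℕ.+ w)) (ℕP.+-comm L (suc n ℕ.* L)) ⟩
    countNew (N ℕ.+ L)
  ≡⟨ sumOver-allMaps-++ cs N L (λ z → 𝟙 (proper z Enew)) ⟩
    sumOver (λ x → sumOver (λ y → 𝟙 (proper (x ++ᵛ y) Enew)) (allMaps cs L)) (allMaps cs N)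
  ≡⟨ sumOver-cong (allMaps cs N) (All.map extensions (allMaps-∈ cs N)) ⟩
    sumOver (λ x → F ℕ.* 𝟙 (proper x Eold)) (allMaps cs N)
  ≡⟨ sumOver-scale F _ (allMaps cs N) ⟩
    F ℕ.* sumOver (λ x → 𝟙 (proper x Eold)) (allMaps cs N)
  ≡⟨ cong (F ℕ.*_) (sym (length-filter _ (allMaps cs N))) ⟩
    F ℕ.* signedChromatic (Book 1 m (suc n)) (suc k)
  ∎
  where
  open ≡-Reasoning
  m L p F N : ℕ
  m = 3 ℕ.+ l
  L = suc l
  p = ℕ.pred (2 ℕ.* suc k)
  F = apart p L
  N = 2 ℕ.+ suc n ℕ.* L
  cs : List ℤ
  cs = colours (suc k)
  Enew Eold : List Edge
  Enew = edges (Book 1 m (2 ℕ.+ n))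
  Eold = edges (Book 1 m (suc n))
  countNew : ℕ → ℕ
  countNew M = sumOver (λ z → 𝟙 (proper {M} z Enew)) (allMaps cs M)
  extensions : {x : Vec ℤ N} → VAll.All (_∈ cs) x →
    sumOver (λ y → 𝟙 (proper (x ++ᵛ y) Enew)) (allMaps cs L) ≡ F ℕ.* 𝟙 (proper x Eold)
  extensions {a ∷ b ∷ r} (a∈cs VAll.∷ b∈cs VAll.∷ _) =
    extensions-count cs p (colours-unique (suc k)) (colours-length (suc k)) l n r a∈cs b∈cs

-- The alternating sum

sumℤ : List ℤ → ℤ
sumℤ = foldr ℤ._+_ (+ 0)

sumℤ-neg : {A : Set} (f : A → ℤ) (xs : List A) →
  sumℤ (map (λ x → - f x) xs) ≡ - sumℤ (map f xs)
sumℤ-neg f [] = refl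
sumℤ-neg f (x ∷ xs) =
  trans (cong (λ s → (- f x) ℤ.+ s) (sumℤ-neg f xs)) (sym (ℤP.neg-distrib-+ (f x) _))

altSum : ℤ → ℕ → ℤ
altSum t n = sumℤ (map (λ i → ((- (+ 1)) ^ i) * (t ^ (n ∸ i))) (upTo (suc n)))

altSum-suc : (t : ℤ) (n : ℕ) → altSum t (suc n) ≡ t ^ suc n - altSum t n
altSum-suc t n = cong₂ ℤ._+_ (ℤP.*-identityˡ (t ^ suc n)) (begin
    sumℤ (map term′ (applyUpTo suc (suc n)))
  ≡⟨ cong sumℤ (LP.map-applyUpTo suc term′ (suc n)) ⟩
    sumℤ (applyUpTo (λ i → term′ (suc i)) (suc n))
  ≡⟨ cong sumℤ (sym (LP.map-upTo (λ i → term′ (suc i)) (suc n))) ⟩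
    sumℤ (map (λ i → term′ (suc i)) (upTo (suc n)))
  ≡⟨ cong sumℤ (LP.map-cong (λ i → flip-sign ((- (+ 1)) ^ i) (t ^ (n ∸ i))) (upTo (suc n))) ⟩
    sumℤ (map (λ i → - term i) (upTo (suc n)))
  ≡⟨ sumℤ-neg term (upTo (suc n)) ⟩
    - altSum t n
  ∎)
  where
  open ≡-Reasoning
  term term′ : ℕ → ℤ
  term i = ((- (+ 1)) ^ i) * (t ^ (n ∸ i))
  term′ i = ((- (+ 1)) ^ i) * (t ^ (suc n ∸ i))
  flip-sign : ∀ s u → (- (+ 1) * s) * u ≡ - (s * u)
  flip-sign = ℤSolver.solve-∀

pos-^ : (t n : ℕ) → (+ t) ^ n ≡ + (t ℕ.^ n)
pos-^ t zero = refl
pos-^ t (suc n) = trans (cong (+ t *_) (pos-^ t n)) (sym (ℤP.pos-* t (t ℕ.^ n)))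

apart≡altSum : (p n : ℕ) → + apart p n ≡ altSum (+ suc p) n
apart≡altSum p zero = refl
apart≡altSum p (suc n) = begin
    + apart p (suc n)
  ≡⟨ difference (+ apart p (suc n)) (+ apart p n) ⟩
    (+ apart p (suc n) ℤ.+ + apart p n) - + apart p n
  ≡⟨ cong (_- + apart p n) (sym (ℤP.pos-+ (apart p (suc n)) (apart p n))) ⟩
    + (apart p (suc n) ℕ.+ apart p n) - + apart p n
  ≡⟨ cong₂ _-_ (cong +_ (apart-recurrence p n)) (apart≡altSum p n) ⟩
    + (suc p ℕ.^ suc n) - altSum (+ suc p) n
  ≡⟨ cong (_- altSum (+ suc p) n) (sym (pos-^ (suc p) (suc n))) ⟩
    (+ suc p) ^ suc n - altSum (+ suc p) n
  ≡⟨ sym (altSum-suc (+ suc p) n) ⟩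
    altSum (+ suc p) (suc n)
  ∎
  where
  open ≡-Reasoning
  difference : ∀ u v → u ≡ (u ℤ.+ v) - v
  difference = ℤSolver.solve-∀

theorem6p7 : (m n : ℕ) → 3 ≤ m → 2 ≤ n → (k : ℕ) → 1 ≤ k →
    + signedChromatic (Book 1 m n) k
      ≡ factor m k * + signedChromatic (Book 1 m (n ∸ 1)) k
theorem6p7 (suc (suc (suc l))) (suc (suc n)) (s≤s (s≤s (s≤s _))) (s≤s (s≤s _)) (suc k) (s≤s _) = begin
    + signedChromatic (Book 1 m (2 ℕ.+ n)) (suc k)
  ≡⟨ cong +_ (deletePage l n k) ⟩
    + (apart p (suc l) ℕ.* χ-old)
  ≡⟨ ℤP.pos-* (apart p (suc l)) χ-old ⟩
    + apart p (suc l) * + χ-old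
  ≡⟨ cong (_* + χ-old) (apart≡altSum p (suc l)) ⟩
    factor m (suc k) * + χ-old
  ∎
  where
  open ≡-Reasoning
  m p χ-old : ℕ
  m = 3 ℕ.+ l
  p = ℕ.pred (2 ℕ.* suc k)
  χ-old = signedChromatic (Book 1 m (suc n)) (suc k)
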